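{- Let $\varphi$ be an LTL formula and let $(B,\prec)$ be a finite well-founded basis. Assume that for every $C\subseteq B$ there is a formula $\varphi_C$ such that (i) $\varphi$ and $\varphi_C$ are equivalent under context $\langle C,B\rangle$, and (ii) for all $C\subseteq C'\subseteq B$, $\varphi_C\models\varphi_{C'}$. Assume further that for every $\psi\in B$ and every $C\subseteq B_{\prec\psi}$ there is a formula $\psi_C$ such that (iii) $\psi$ and $\psi_C$ are equivalent under context $\langle C,B_{\prec\psi}\rangle$, and (iv) for all $C\subseteq C'\subseteq B_{\prec\psi}$, $\psi_C\models\psi_{C'}$. Then $$\varphi\equiv\bigvee_{C\subseteq B}\Big(\varphi_C\wedge\bigwedge_{\psi\in C}\psi_{C\cap B_{\prec\psi}}\Big).$$
   Context: LTL formulas are interpreted on infinite words over $2^{Ap}$ ($Ap$ finite); $\varphi\equiv\psi$ means equal sets of models, $\varphi\models\psi$ means every model of $\varphi$ is a model of $\psi$. A basis is a set $B$ of formulas; for $C\subseteq B$, the context $\langle C,B\rangle$ has language $\mathcal L\langle C,B\rangle$ = set of words satisfying every formula of $C$ and no formula of $B\setminus C$; two formulas are equivalent under $\langle C,B\rangle$ if they are satisfied by exactly the same words of $\mathcal L\langle C,B\rangle$. A well-founded basis is a pair $(B,\prec)$ with $\prec\subseteq B\times B$ a well-founded order; $B_{\prec\psi}=\{\chi\in B\mid\chi\prec\psi\}$. -}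

module Defs where

open import Data.Nat using (ℕ; zero; suc; _+_; _<_)
open import Data.Bool using (Bool; true; false; T; if_then_else_)
open import Data.Fin using (Fin)
open import Data.Fin.Subset using (Subset; _∈_; _∉_; _⊆_; _∩_)
open import Data.Vec using (Vec; []; _∷_; lookup; tabulate)
open import Data.List using (List; []; _∷_; map; concatMap; foldr; allFin)
open import Data.Product using (_×_; ∃-syntax)
open import Data.Sum using (_⊎_)
open import Data.Unit using (⊤)
open import Data.Empty using (⊥)
open import Relation.Nullary using (¬_)
open import Relation.Binary.PropositionalEquality using (_≡_)

data LTL (n : ℕ) : Set where
  tt ff : LTL n
  ap    : Fin n → LTL n
  ¬'_   : LTL n → LTL n
  _∧'_ _∨'_ : LTL n → LTL n → LTL n
  X'_   : LTL n → LTL n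
  _U'_  : LTL n → LTL n → LTL n

Word : ℕ → Set
Word n = ℕ → Subset n

suffix : ∀ {n} → Word n → ℕ → Word n
suffix w i j = w (i + j)

_⊨_ : ∀ {n} → Word n → LTL n → Set
w ⊨ tt = ⊤
w ⊨ ff = ⊥
w ⊨ ap p = p ∈ w 0
w ⊨ (¬' φ) = ¬ (w ⊨ φ)
w ⊨ (φ ∧' ψ) = (w ⊨ φ) × (w ⊨ ψ)
w ⊨ (φ ∨' ψ) = (w ⊨ φ) ⊎ (w ⊨ ψ)
w ⊨ (X' φ) = suffix w 1 ⊨ φ
w ⊨ (φ U' ψ) = ∃[ j ] ((suffix w j ⊨ ψ) × (∀ i → i < j → suffix w i ⊨ φ))

_≡ᴸ_ : ∀ {n} → LTL n → LTL n → Set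
φ ≡ᴸ ψ = ∀ w → ((w ⊨ φ → w ⊨ ψ) × (w ⊨ ψ → w ⊨ φ))

_⊨ᴸ_ : ∀ {n} → LTL n → LTL n → Set
φ ⊨ᴸ ψ = ∀ w → w ⊨ φ → w ⊨ ψ

-- A finite basis is an indexed family B : Fin k → LTL n; subsets of the
-- basis are subsets of the index set Fin k.  A context ⟨C, P⟩ (with
-- P a sub-basis given by a subset of indices, C ⊆ P):
-- w ∈ L⟨C,P⟩ iff w satisfies B i for i ∈ C and falsifies B i for i ∈ P∖C.
InContext : ∀ {n k} → (Fin k → LTL n) → Subset k → Subset k → Word n → Set
InContext B C P w =
  ∀ i → i ∈ P → ((i ∈ C → w ⊨ B i) × (i ∉ C → ¬ (w ⊨ B i)))

EquivUnder : ∀ {n k} → (Fin k → LTL n) → Subset k → Subset k →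
             LTL n → LTL n → Set
EquivUnder B C P φ ψ =
  ∀ w → InContext B C P w → ((w ⊨ φ → w ⊨ ψ) × (w ⊨ ψ → w ⊨ φ))

full : ∀ {k} → Subset k
full = tabulate (λ _ → true)

-- B_{≺ψ}: the indices strictly below i w.r.t. a relation given by a
-- Boolean matrix r (r j i = true means j ≺ i).
below : ∀ {k} → (Fin k → Fin k → Bool) → Fin k → Subset k
below r i = tabulate (λ j → r j i)

allSubsets : ∀ k → List (Subset k)
allSubsets zero = [] ∷ []
allSubsets (suc k) = concatMap (λ s → (false ∷ s) ∷ (true ∷ s) ∷ []) (allSubsets k)

⋀ : ∀ {n} → List (LTL n) → LTL n
⋀ = foldr _∧'_ tt

⋁ : ∀ {n} → List (LTL n) → LTL n
⋁ = foldr _∨'_ ff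

⋀∈ : ∀ {n k} → Subset k → (Fin k → LTL n) → LTL n
⋀∈ C f = ⋀ (map (λ i → if lookup C i then f i else tt) (allFin _))

⋁⊆ : ∀ {n} k → (Subset k → LTL n) → LTL n
⋁⊆ k f = ⋁ (map f (allSubsets k))

{-# OPTIONS --safe #-}
-- Every word w determines the set C_w ⊆ B of basis formulas it satisfies, and
-- w lies in the context ⟨C_w ∩ P, P⟩ of every sub-basis P.  If w ⊨ φ, then the
-- disjunct for C_w holds by (i) and (iii).  Conversely, if w satisfies the
-- disjunct for some C, well-founded induction along ≺ shows C ⊆ C_w: for ψ ∈ C,
-- the hypothesis C ∩ B_{≺ψ} ⊆ C_w ∩ B_{≺ψ} lets (iv) lift ψ_{C∩B_{≺ψ}} to
-- ψ_{C_w∩B_{≺ψ}}, which by (iii) gives w ⊨ ψ.  Then (ii) lifts φ_C to φ_{C_w},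
-- and (i) gives w ⊨ φ.
module Submission where

open import Defs
open import Data.Nat using (ℕ)
open import Data.Bool using (Bool; T; true; false; if_then_else_)
open import Data.Bool.Properties using (T-≡)
open import Data.Fin using (Fin)
open import Data.Fin.Subset using (Subset; _⊆_; _∩_; _∈_)
open import Data.Fin.Subset.Properties using (x∈p∩q⁺; x∈p∩q⁻)
open import Data.Vec using ([]; _∷_; lookup; tabulate)
open import Data.Vec.Properties using ([]=⇒lookup; lookup⇒[]=; lookup∘tabulate)
open import Data.List using (List; []; _∷_; map; allFin)
import Data.List.Membership.Propositional as List
open import Data.List.Membership.Propositional.Properties using (∈-allFin; ∈-concatMap⁺)
open import Data.List.Relation.Unary.Any as Any using (here; there)
open import Data.Product using (_×_; _,_; proj₁; proj₂; ∃-syntax)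
open import Data.Sum using (inj₁; inj₂)
open import Data.Unit using (tt)
open import Function.Bundles using (_⇔_; mk⇔; Equivalence)
open import Induction.WellFounded using (WellFounded; Acc; acc)
open import Axiom.ExcludedMiddle using (ExcludedMiddle)
open import Level using (0ℓ)
open import Relation.Nullary.Decidable using (isYes; toWitness; fromWitness)
open import Relation.Binary.PropositionalEquality using (refl; sym; trans)

open Equivalence using (to; from)

∈-tabulate⇔T : ∀ {k} (f : Fin k → Bool) (i : Fin k) → i ∈ tabulate f ⇔ T (f i)
∈-tabulate⇔T f i = mk⇔
  (λ i∈ → from T-≡ (trans (sym (lookup∘tabulate f i)) ([]=⇒lookup i∈)))
  (λ fi → lookup⇒[]= i (tabulate f) (trans (lookup∘tabulate f i) (to T-≡ fi)))

∈-allSubsets : ∀ {k} (C : Subset k) → C List.∈ allSubsets k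
∈-allSubsets []      = here refl
∈-allSubsets (b ∷ C) = ∈-concatMap⁺ extend (Any.map (λ { refl → ∈-extend b }) (∈-allSubsets C))
  where
    extend : Subset _ → List (Subset _)
    extend s = (false ∷ s) ∷ (true ∷ s) ∷ []

    ∈-extend : ∀ b → (b ∷ C) List.∈ extend C
    ∈-extend false = here refl
    ∈-extend true  = there (here refl)

module _ {n : ℕ} {w : Word n} where

  ⊨⋁-map⁺ : ∀ {A : Set} (f : A → LTL n) {xs : List A} {x : A} →
            x List.∈ xs → w ⊨ f x → w ⊨ ⋁ (map f xs)
  ⊨⋁-map⁺ f (here refl) p = inj₁ p
  ⊨⋁-map⁺ f (there x∈)  p = inj₂ (⊨⋁-map⁺ f x∈ p)

  ⊨⋁-map⁻ : ∀ {A : Set} (f : A → LTL n) (xs : List A) →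
            w ⊨ ⋁ (map f xs) → ∃[ x ] w ⊨ f x
  ⊨⋁-map⁻ f (x ∷ xs) (inj₁ p) = x , p
  ⊨⋁-map⁻ f (x ∷ xs) (inj₂ p) = ⊨⋁-map⁻ f xs p

  ⊨⋀-map⁺ : ∀ {A : Set} (f : A → LTL n) (xs : List A) →
            (∀ x → w ⊨ f x) → w ⊨ ⋀ (map f xs)
  ⊨⋀-map⁺ f []       p = tt
  ⊨⋀-map⁺ f (x ∷ xs) p = p x , ⊨⋀-map⁺ f xs p

  ⊨⋀-map⁻ : ∀ {A : Set} (f : A → LTL n) {xs : List A} →
            w ⊨ ⋀ (map f xs) → ∀ {x} → x List.∈ xs → w ⊨ f x
  ⊨⋀-map⁻ f (p , _) (here refl) = p
  ⊨⋀-map⁻ f (_ , p) (there x∈)  = ⊨⋀-map⁻ f p x∈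

  ⊨⋁⊆⁺ : ∀ {k} (f : Subset k → LTL n) (C : Subset k) → w ⊨ f C → w ⊨ ⋁⊆ k f
  ⊨⋁⊆⁺ f C = ⊨⋁-map⁺ f (∈-allSubsets C)

  ⊨⋁⊆⁻ : ∀ {k} (f : Subset k → LTL n) → w ⊨ ⋁⊆ k f → ∃[ C ] w ⊨ f C
  ⊨⋁⊆⁻ {k} f = ⊨⋁-map⁻ f (allSubsets k)

  ⊨⋀∈⁺ : ∀ {k} (C : Subset k) (f : Fin k → LTL n) →
         (∀ {i} → i ∈ C → w ⊨ f i) → w ⊨ ⋀∈ C f
  ⊨⋀∈⁺ {k} C f p = ⊨⋀-map⁺ _ (allFin k) guarded
    where
      guarded : ∀ i → w ⊨ (if lookup C i then f i else tt)
      guarded i with lookup C i in eq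
      ... | true  = p (lookup⇒[]= i C eq)
      ... | false = tt

  ⊨⋀∈⁻ : ∀ {k} (C : Subset k) (f : Fin k → LTL n) →
         w ⊨ ⋀∈ C f → ∀ {i} → i ∈ C → w ⊨ f i
  ⊨⋀∈⁻ {k} C f p {i} i∈C with ⊨⋀-map⁻ _ p (∈-allFin i)
  ... | q rewrite []=⇒lookup i∈C = q

module _ (em : ExcludedMiddle 0ℓ) {n k : ℕ} (B : Fin k → LTL n) (w : Word n) where

  satisfied : Subset k
  satisfied = tabulate (λ i → isYes (em {w ⊨ B i}))

  ∈-satisfied⇔ : ∀ i → i ∈ satisfied ⇔ w ⊨ B i
  ∈-satisfied⇔ i = mk⇔
    (λ i∈ → toWitness (to (∈-tabulate⇔T _ i) i∈))
    (λ ⊨B → from (∈-tabulate⇔T _ i) (fromWitness ⊨B))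

  inContext-satisfied : ∀ P → InContext B satisfied P w
  inContext-satisfied P i _ = to (∈-satisfied⇔ i) , λ i∉ ⊨B → i∉ (from (∈-satisfied⇔ i) ⊨B)

  inContext-satisfied∩ : ∀ P → InContext B (satisfied ∩ P) P w
  inContext-satisfied∩ P i i∈P =
    (λ i∈ → to (∈-satisfied⇔ i) (proj₁ (x∈p∩q⁻ satisfied P i∈)))
    , λ i∉ ⊨B → i∉ (x∈p∩q⁺ (from (∈-satisfied⇔ i) ⊨B , i∈P))

module Approximants (em : ExcludedMiddle 0ℓ) {n k : ℕ} (B : Fin k → LTL n) (r : Fin k → Fin k → Bool)
         (ψC : Fin k → Subset k → LTL n)
         (ψC-equiv : ∀ i C → C ⊆ below r i → EquivUnder B C (below r i) (B i) (ψC i C))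
         (ψC-mono : ∀ i C C′ → C ⊆ C′ → C′ ⊆ below r i → ψC i C ⊨ᴸ ψC i C′)
         where

  ψ∩below : Subset k → Fin k → LTL n
  ψ∩below C i = ψC i (C ∩ below r i)

  ∩below⊆below : ∀ C i → C ∩ below r i ⊆ below r i
  ∩below⊆below C i j∈ = proj₂ (x∈p∩q⁻ C (below r i) j∈)

  ⊨ψ∩below-satisfied⇔⊨B : ∀ w i → w ⊨ ψ∩below (satisfied em B w) i ⇔ w ⊨ B i
  ⊨ψ∩below-satisfied⇔⊨B w i = mk⇔ (proj₂ equiv) (proj₁ equiv)
    where
      Cw : Subset k
      Cw = satisfied em B w

      equiv : (w ⊨ B i → w ⊨ ψ∩below Cw i) × (w ⊨ ψ∩below Cw i → w ⊨ B i)
      equiv = ψC-equiv i (Cw ∩ below r i) (∩below⊆below Cw i) w (inContext-satisfied∩ em B w (below r i))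

  ⊨⋀ψ⇒⊆satisfied : WellFounded (λ i j → T (r i j)) →
                   ∀ C w → w ⊨ ⋀∈ C (ψ∩below C) → C ⊆ satisfied em B w
  ⊨⋀ψ⇒⊆satisfied wf C w ⊨⋀ψ {i} i∈C = from (∈-satisfied⇔ em B w i) (⊨B (wf i) i∈C)
    where
      Cw : Subset k
      Cw = satisfied em B w

      ⊨B : ∀ {i} → Acc (λ i j → T (r i j)) i → i ∈ C → w ⊨ B i
      ⊨B {i} (acc below-acc) i∈C =
        to (⊨ψ∩below-satisfied⇔⊨B w i)
          (ψC-mono i _ _ C∩below⊆Cw∩below (∩below⊆below Cw i) w (⊨⋀∈⁻ C _ ⊨⋀ψ i∈C))
        where
          C∩below⊆Cw∩below : C ∩ below r i ⊆ Cw ∩ below r i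
          C∩below⊆Cw∩below {j} j∈ with x∈p∩q⁻ C (below r i) j∈
          ... | j∈C , j≺i = x∈p∩q⁺
            ( from (∈-satisfied⇔ em B w j)
                (⊨B (below-acc (to (∈-tabulate⇔T (λ j → r j i) j) j≺i)) j∈C)
            , j≺i)

lemma4p5 : ExcludedMiddle 0ℓ →
    {n k : ℕ} (φ : LTL n) (B : Fin k → LTL n) (r : Fin k → Fin k → Bool) →
    WellFounded (λ i j → T (r i j)) →
    (φC : Subset k → LTL n) →
    (∀ C → EquivUnder B C full φ (φC C)) →
    (∀ C C′ → C ⊆ C′ → φC C ⊨ᴸ φC C′) →
    (ψC : Fin k → Subset k → LTL n) →
    (∀ i C → C ⊆ below r i → EquivUnder B C (below r i) (B i) (ψC i C)) →
    (∀ i C C′ → C ⊆ C′ → C′ ⊆ below r i → ψC i C ⊨ᴸ ψC i C′) →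
    φ ≡ᴸ ⋁⊆ k (λ C → φC C ∧' ⋀∈ C (λ i → ψC i (C ∩ below r i)))
lemma4p5 em {n} {k} φ B r wf φC φC-equiv φC-mono ψC ψC-equiv ψC-mono w = ⊨φ⇒ , ⇒⊨φ
  where
    open Approximants em B r ψC ψC-equiv ψC-mono

    Cw : Subset k
    Cw = satisfied em B w

    disjunct : Subset k → LTL n
    disjunct C = φC C ∧' ⋀∈ C (ψ∩below C)

    φ⇔φC[Cw] : (w ⊨ φ → w ⊨ φC Cw) × (w ⊨ φC Cw → w ⊨ φ)
    φ⇔φC[Cw] = φC-equiv Cw w (inContext-satisfied em B w full)

    ⊨φ⇒ : w ⊨ φ → w ⊨ ⋁⊆ k disjunct
    ⊨φ⇒ ⊨φ = ⊨⋁⊆⁺ disjunct Cw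
      ( proj₁ φ⇔φC[Cw] ⊨φ
      , ⊨⋀∈⁺ Cw _ (λ {i} i∈ → from (⊨ψ∩below-satisfied⇔⊨B w i) (to (∈-satisfied⇔ em B w i) i∈)))

    ⇒⊨φ : w ⊨ ⋁⊆ k disjunct → w ⊨ φ
    ⇒⊨φ ⊨⋁ with ⊨⋁⊆⁻ disjunct ⊨⋁
    ... | C , ⊨φC , ⊨⋀ψ = proj₂ φ⇔φC[Cw] (φC-mono C Cw (⊨⋀ψ⇒⊆satisfied wf C w ⊨⋀ψ) w ⊨φC)
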